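{- If $\pi,\pi'\in S_n$ satisfy $\pi'\le_{\mathrm{left}}\pi$, then $|s^{ -1}(\pi')|\ge|s^{ -1}(\pi)|$.
   Context: $S_n$ is the set of permutations of $[n]$ in one-line notation. The stack-sorting map $s$: $s$ of the empty permutation is empty, and if $\pi=LmR$ with $m$ the largest entry, then $s(\pi)=s(L)s(R)m$; $s^{ -1}(\pi)=\{\tau\in S_n:s(\tau)=\pi\}$. For $\tau\in S_n$ and $i\in[n-1]$, $\widetilde t_i(\tau)$ is obtained by swapping the positions of $i$ and $i+1$ if $i+1$ appears to the left of $i$ in $\tau$, and $\widetilde t_i(\tau)=\tau$ otherwise. The left weak order is defined by $\pi'\le_{\mathrm{left}}\pi$ iff there is a sequence $i_1,\dots,i_m\in[n-1]$ with $\widetilde t_{i_m}\circ\cdots\circ\widetilde t_{i_1}(\pi)=\pi'$. -}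

module Defs where

open import Data.Nat using (ℕ; zero; suc; _+_; _≤_; _<_; _≡ᵇ_)
open import Data.Bool using (Bool; true; false; if_then_else_)
open import Data.List using (List; []; _∷_; _++_; [_]; map; upTo; length; foldl)
open import Data.List.Relation.Unary.All using (All)
open import Data.List.Relation.Binary.Permutation.Propositional using (_↭_)
open import Data.Product using (_×_; _,_; ∃)
open import Data.Maybe using (Maybe; just; nothing)
open import Relation.Binary.PropositionalEquality using (_≡_)

-- Permutations are lists in one-line notation with entries in ℕ.
-- [1..n]
range : ℕ → List ℕ
range n = map suc (upTo n)

InS : ℕ → List ℕ → Set
InS n π = π ↭ range n

maxOf : ℕ → List ℕ → ℕ
maxOf m [] = m
maxOf m (y ∷ ys) = if m Data.Nat.<ᵇ y then maxOf y ys else maxOf m ys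

splitAt : ℕ → List ℕ → List ℕ × List ℕ
splitAt m [] = [] , []
splitAt m (y ∷ ys) with m ≡ᵇ y
... | true  = [] , ys
... | false with splitAt m ys
...   | L , R = (y ∷ L) , R

decomp : List ℕ → Maybe (List ℕ × ℕ × List ℕ)
decomp [] = nothing
decomp (x ∷ xs) with maxOf x xs
... | m with splitAt m (x ∷ xs)
...   | L , R = just (L , m , R)

-- stack-sorting with fuel; fuel = length suffices since L and R are shorter
sFuel : ℕ → List ℕ → List ℕ
sFuel zero _ = []
sFuel (suc k) xs with decomp xs
... | nothing = []
... | just (L , m , R) = sFuel k L ++ sFuel k R ++ [ m ]

-- the stack-sorting map: s(LmR) = s(L) s(R) m, s(empty) = empty
s : List ℕ → List ℕ
s xs = sFuel (length xs) xs

occursLeftOf : ℕ → ℕ → List ℕ → Bool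
occursLeftOf b a [] = false
occursLeftOf b a (y ∷ ys) =
  if y ≡ᵇ b then true else (if y ≡ᵇ a then false else occursLeftOf b a ys)

-- exchange the values i and i+1 (= swapping their positions in a permutation)
swapVal : ℕ → ℕ → ℕ
swapVal i y = if y ≡ᵇ i then suc i else (if y ≡ᵇ suc i then i else y)

ttilde : ℕ → List ℕ → List ℕ
ttilde i τ = if occursLeftOf (suc i) i τ then map (swapVal i) τ else τ

applySeq : List ℕ → List ℕ → List ℕ
applySeq is π = foldl (λ τ i → ttilde i τ) π is

LeftLe : ℕ → List ℕ → List ℕ → Set
LeftLe n π' π = ∃ λ (is : List ℕ) → All (λ i → 1 ≤ i × suc i ≤ n) is × applySeq is π ≡ π'

Preimage : ℕ → List ℕ → List ℕ → Set
Preimage n π τ = InS n τ × s τ ≡ π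

module Submission where

-- Write σ = σ_i for the transposition of the values i and i+1.  The heart of the proof is
-- the commutation lemma `sFuel-swap`: if i+1 precedes i in s(τ), then s(σ τ) = σ s(τ).  The maximum m
-- is never i+1 (the maximum comes last in s(τ), while i+1 comes before i), so σ keeps m
-- the maximum and the decomposition of σ τ is σL m σR.  If i and i+1 both lie in L or
-- both in R, the induction hypothesis applies to that side; on every other side σ is
-- monotone, and a monotone injective relabelling commutes with s (`sFuel-map-monotone`).
--
-- Consequently, when t̃_i acts nontrivially on π (i+1 precedes i in π), τ ↦ σ τ injects
-- s⁻¹(π) into s⁻¹(σ π) = s⁻¹(t̃_i π).  Iterating along the sequence i_1, …, i_m that
-- witnesses π' ≤left π transports any duplicate-free list of preimages of π to one of
-- preimages of π' of the same length.

open import Defs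
open import Data.Nat using (ℕ; zero; suc; _≤_; _≡ᵇ_; _<ᵇ_; z≤n; s≤s; s≤s⁻¹)
open import Data.Nat.Properties
open import Data.Bool using (true; false; T)
open import Data.Unit using (tt)
open import Data.List using (List; []; _∷_; _++_; [_]; map; length)
open import Data.List.Properties
  using (map-++; ++-assoc; length-map; map-injective; map-id-local; length-++-sucʳ; length-++-≤ˡ; length-++-≤ʳ)
open import Data.List.Relation.Unary.All as All using (All; []; _∷_)
import Data.List.Relation.Unary.All.Properties as All
open import Data.List.Relation.Unary.Any using (here; there)
open import Data.List.Relation.Unary.AllPairs using ([]; _∷_)
open import Data.List.Membership.Propositional using (_∈_; _∉_)
open import Data.List.Membership.Propositional.Properties
  using (∈-++⁺ˡ; ∈-++⁺ʳ; ∈-++⁻; ∈-map⁺; ∈-map⁻; ∈-upTo⁺; ∈-∃++)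
open import Data.List.Membership.DecPropositional _≟_ using (_∈?_)
open import Data.List.Relation.Binary.Subset.Propositional using (_⊆_)
open import Data.List.Relation.Unary.Unique.Propositional using (Unique)
import Data.List.Relation.Unary.Unique.Propositional.Properties as Unique
open import Data.List.Relation.Binary.Permutation.Propositional
  using (_↭_; prep; swap; ↭-refl; ↭-trans; ↭-sym; ↭⇒↭ₛ; module PermutationReasoning)
import Data.List.Relation.Binary.Permutation.Propositional.Properties as Perm
import Data.List.Relation.Binary.Permutation.Setoid.Properties as PermSetoid
open import Data.Product using (_×_; _,_; ∃; proj₁; proj₂)
open import Data.Sum using (_⊎_; inj₁; inj₂)
open import Data.Empty using (⊥; ⊥-elim)
open import Function.Base using (_∘′_)
open import Function.Definitions using (Injective)
open import Relation.Nullary using (¬_; yes; no)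
open import Relation.Binary.PropositionalEquality hiding ([_])

≡ᵇ-refl : ∀ m → (m ≡ᵇ m) ≡ true
≡ᵇ-refl zero = refl
≡ᵇ-refl (suc m) = ≡ᵇ-refl m

≢⇒≡ᵇ-false : ∀ m n → m ≢ n → (m ≡ᵇ n) ≡ false
≢⇒≡ᵇ-false m n m≢n with m ≡ᵇ n in e
... | true = ⊥-elim (m≢n (≡ᵇ⇒≡ m n (subst T (sym e) tt)))
... | false = refl

maxOf-∈ : ∀ x xs → maxOf x xs ∈ x ∷ xs
maxOf-∈ x [] = here refl
maxOf-∈ x (y ∷ ys) with x <ᵇ y
... | true = there (maxOf-∈ y ys)
... | false with maxOf-∈ x ys
...   | here e = here e
...   | there p = there (there p)

maxOf-≥ : ∀ x xs {z} → z ∈ x ∷ xs → z ≤ maxOf x xs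
maxOf-≥ x [] (here refl) = ≤-refl
maxOf-≥ x (y ∷ ys) z∈ with x <ᵇ y in e
maxOf-≥ x (y ∷ ys) (here refl) | true = ≤-trans (<⇒≤ (<ᵇ⇒< x y (subst T (sym e) tt))) (maxOf-≥ y ys (here refl))
maxOf-≥ x (y ∷ ys) (there z∈) | true = maxOf-≥ y ys z∈
maxOf-≥ x (y ∷ ys) (here refl) | false = maxOf-≥ x ys (here refl)
maxOf-≥ x (y ∷ ys) (there (here refl)) | false =
  ≤-trans (≮⇒≥ (λ x<y → subst T e (<⇒<ᵇ x<y))) (maxOf-≥ x ys (here refl))
maxOf-≥ x (y ∷ ys) (there (there z∈)) | false = maxOf-≥ x ys (there z∈)

maxOf-unique : ∀ x xs M → M ∈ x ∷ xs → (∀ {z} → z ∈ x ∷ xs → z ≤ M) → maxOf x xs ≡ M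
maxOf-unique x xs M M∈ M-max = ≤-antisym (M-max (maxOf-∈ x xs)) (maxOf-≥ x xs M∈)

splitAt-++ : ∀ m ys {L R} → m ∈ ys → splitAt m ys ≡ (L , R) → ys ≡ L ++ m ∷ R
splitAt-++ m (y ∷ ys) m∈ eq with m ≡ᵇ y in e
splitAt-++ m (y ∷ ys) m∈ refl | true = cong (_∷ ys) (sym (≡ᵇ⇒≡ m y (subst T (sym e) tt)))
splitAt-++ m (y ∷ ys) m∈ eq | false with splitAt m ys in e'
splitAt-++ m (y ∷ ys) (here refl) eq | false | _ with () ← trans (sym e) (≡ᵇ-refl m)
splitAt-++ m (y ∷ ys) (there m∈) refl | false | _ = cong (y ∷_) (splitAt-++ m ys m∈ e')

splitAt-map : ∀ (g : ℕ → ℕ) m ys {L R} → (∀ {y} → y ∈ ys → g m ≡ g y → m ≡ y) →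
  splitAt m ys ≡ (L , R) → splitAt (g m) (map g ys) ≡ (map g L , map g R)
splitAt-map g m [] inj refl = refl
splitAt-map g m (y ∷ ys) inj eq with m ≟ y
... | yes refl rewrite ≡ᵇ-refl m | ≡ᵇ-refl (g m) with refl ← eq = refl
... | no m≢y rewrite ≢⇒≡ᵇ-false m y m≢y | ≢⇒≡ᵇ-false (g m) (g y) (m≢y ∘′ inj (here refl))
    with splitAt m ys in e
...   | L' , R' with refl ← eq = cong (λ { (A , B) → (g y ∷ A) , B }) (splitAt-map g m ys (inj ∘′ there) e)

top : ℕ → List ℕ → ℕ
top x xs = maxOf x xs

left right : ℕ → List ℕ → List ℕ
left x xs = proj₁ (splitAt (top x xs) (x ∷ xs))
right x xs = proj₂ (splitAt (top x xs) (x ∷ xs))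

cons-split : ∀ x xs → x ∷ xs ≡ left x xs ++ top x xs ∷ right x xs
cons-split x xs = splitAt-++ (top x xs) (x ∷ xs) (maxOf-∈ x xs) refl

left-⊆ : ∀ x xs → left x xs ⊆ x ∷ xs
left-⊆ x xs z∈ = subst (_ ∈_) (sym (cons-split x xs)) (∈-++⁺ˡ z∈)

right-⊆ : ∀ x xs → right x xs ⊆ x ∷ xs
right-⊆ x xs z∈ = subst (_ ∈_) (sym (cons-split x xs)) (∈-++⁺ʳ (left x xs) (there z∈))

∈-left-or-right : ∀ x xs {z} → z ∈ x ∷ xs → z ≢ top x xs → z ∈ left x xs ⊎ z ∈ right x xs
∈-left-or-right x xs z∈ z≢m with ∈-++⁻ (left x xs) (subst (_ ∈_) (cons-split x xs) z∈)
... | inj₁ z∈L = inj₁ z∈L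
... | inj₂ (here z≡m) = ⊥-elim (z≢m z≡m)
... | inj₂ (there z∈R) = inj₂ z∈R

-- Both sides are strictly shorter, so fuel k suffices for them when suc k sufficed for x ∷ xs.
split-length : ∀ k x xs → length (x ∷ xs) ≤ suc k → length (left x xs) ≤ k × length (right x xs) ≤ k
split-length k x xs len = ≤-trans (length-++-≤ˡ L) L++R≤k , ≤-trans (length-++-≤ʳ R {L}) L++R≤k
  where
  L = left x xs
  R = right x xs
  L++R≤k : length (L ++ R) ≤ k
  L++R≤k = s≤s⁻¹ (subst (_≤ suc k) (trans (cong length (cons-split x xs)) (length-++-sucʳ L (top x xs) R)) len)

sFuel-cons : ∀ k x xs → sFuel (suc k) (x ∷ xs) ≡ sFuel k (left x xs) ++ sFuel k (right x xs) ++ [ top x xs ]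
sFuel-cons k x xs with maxOf x xs
... | m with splitAt m (x ∷ xs)
...   | L , R = refl

sFuel-⊆ : ∀ k xs → sFuel k xs ⊆ xs
sFuel-⊆ (suc k) (x ∷ xs) z∈ with ∈-++⁻ (sFuel k (left x xs)) (subst (_ ∈_) (sFuel-cons k x xs) z∈)
... | inj₁ z∈sL = left-⊆ x xs (sFuel-⊆ k (left x xs) z∈sL)
... | inj₂ z∈sRm with ∈-++⁻ (sFuel k (right x xs)) z∈sRm
...   | inj₁ z∈sR = right-⊆ x xs (sFuel-⊆ k (right x xs) z∈sR)
...   | inj₂ (here refl) = maxOf-∈ x xs

sFuel-⊇ : ∀ k xs → length xs ≤ k → xs ⊆ sFuel k xs
sFuel-⊇ (suc k) (x ∷ xs) len {z} z∈ = subst (_ ∈_) (sym (sFuel-cons k x xs)) z∈sLsRm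
  where
  sL = sFuel k (left x xs)
  sR = sFuel k (right x xs)
  lens = split-length k x xs len
  z∈sLsRm : z ∈ sL ++ sR ++ [ top x xs ]
  z∈sLsRm with z ≟ top x xs
  ... | yes refl = ∈-++⁺ʳ sL (∈-++⁺ʳ sR (here refl))
  ... | no z≢m with ∈-left-or-right x xs z∈ z≢m
  ...   | inj₁ z∈L = ∈-++⁺ˡ (sFuel-⊇ k (left x xs) (proj₁ lens) z∈L)
  ...   | inj₂ z∈R = ∈-++⁺ʳ sL (∈-++⁺ˡ (sFuel-⊇ k (right x xs) (proj₂ lens) z∈R))

top-map : ∀ (g : ℕ → ℕ) x xs → (∀ {y} → y ∈ x ∷ xs → g y ≤ g (top x xs)) →
  top (g x) (map g xs) ≡ g (top x xs)
top-map g x xs below = maxOf-unique (g x) (map g xs) (g (top x xs)) (∈-map⁺ g (maxOf-∈ x xs)) g-below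
  where
  g-below : ∀ {z} → z ∈ g x ∷ map g xs → z ≤ g (top x xs)
  g-below z∈ with y , y∈ , refl ← ∈-map⁻ g z∈ = below y∈

splitAt-top-map : ∀ (g : ℕ → ℕ) x xs → Injective _≡_ _≡_ g → (∀ {y} → y ∈ x ∷ xs → g y ≤ g (top x xs)) →
  splitAt (top (g x) (map g xs)) (g x ∷ map g xs) ≡ (map g (left x xs) , map g (right x xs))
splitAt-top-map g x xs inj below rewrite top-map g x xs below =
  splitAt-map g (top x xs) (x ∷ xs) (λ _ → inj) refl

sFuel-map-step : ∀ (g : ℕ → ℕ) k x xs → Injective _≡_ _≡_ g → (∀ {y} → y ∈ x ∷ xs → g y ≤ g (top x xs)) →
  sFuel k (map g (left x xs)) ≡ map g (sFuel k (left x xs)) →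
  sFuel k (map g (right x xs)) ≡ map g (sFuel k (right x xs)) →
  sFuel (suc k) (map g (x ∷ xs)) ≡ map g (sFuel (suc k) (x ∷ xs))
sFuel-map-step g k x xs inj below eqL eqR = begin
  sFuel (suc k) (g x ∷ map g xs)
    ≡⟨ sFuel-cons k (g x) (map g xs) ⟩
  sFuel k (left (g x) (map g xs)) ++ sFuel k (right (g x) (map g xs)) ++ [ top (g x) (map g xs) ]
    ≡⟨ cong₂ (λ A B → sFuel k A ++ sFuel k B ++ [ top (g x) (map g xs) ])
             (cong proj₁ split-map) (cong proj₂ split-map) ⟩
  sFuel k (map g L) ++ sFuel k (map g R) ++ [ top (g x) (map g xs) ]
    ≡⟨ cong₂ (λ A B → A ++ B ++ [ top (g x) (map g xs) ]) eqL eqR ⟩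
  map g (sFuel k L) ++ map g (sFuel k R) ++ [ top (g x) (map g xs) ]
    ≡⟨ cong (λ M → map g (sFuel k L) ++ map g (sFuel k R) ++ [ M ]) (top-map g x xs below) ⟩
  map g (sFuel k L) ++ map g (sFuel k R) ++ map g [ top x xs ]
    ≡⟨ cong (map g (sFuel k L) ++_) (sym (map-++ g (sFuel k R) [ top x xs ])) ⟩
  map g (sFuel k L) ++ map g (sFuel k R ++ [ top x xs ])
    ≡⟨ sym (map-++ g (sFuel k L) (sFuel k R ++ [ top x xs ])) ⟩
  map g (sFuel k L ++ sFuel k R ++ [ top x xs ])
    ≡⟨ cong (map g) (sym (sFuel-cons k x xs)) ⟩
  map g (sFuel (suc k) (x ∷ xs)) ∎
  where
  open ≡-Reasoning
  L = left x xs
  R = right x xs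
  split-map = splitAt-top-map g x xs inj below

MonotoneOn : (ℕ → ℕ) → List ℕ → Set
MonotoneOn g xs = ∀ {x y} → x ∈ xs → y ∈ xs → x ≤ y → g x ≤ g y

sFuel-map-monotone : ∀ (g : ℕ → ℕ) → Injective _≡_ _≡_ g → ∀ k xs → MonotoneOn g xs →
  sFuel k (map g xs) ≡ map g (sFuel k xs)
sFuel-map-monotone g inj zero xs mono = refl
sFuel-map-monotone g inj (suc k) [] mono = refl
sFuel-map-monotone g inj (suc k) (x ∷ xs) mono =
  sFuel-map-step g k x xs inj (λ y∈ → mono y∈ (maxOf-∈ x xs) (maxOf-≥ x xs y∈))
    (sFuel-map-monotone g inj k (left x xs) (λ p q → mono (left-⊆ x xs p) (left-⊆ x xs q)))
    (sFuel-map-monotone g inj k (right x xs) (λ p q → mono (right-⊆ x xs p) (right-⊆ x xs q)))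

swap-i : ∀ i → swapVal i i ≡ suc i
swap-i i rewrite ≡ᵇ-refl i = refl

swap-suc-i : ∀ i → swapVal i (suc i) ≡ i
swap-suc-i i rewrite ≢⇒≡ᵇ-false (suc i) i (1+n≢n {i}) | ≡ᵇ-refl i = refl

swap-fix : ∀ i {y} → y ≢ i → y ≢ suc i → swapVal i y ≡ y
swap-fix i {y} y≢i y≢si rewrite ≢⇒≡ᵇ-false y i y≢i | ≢⇒≡ᵇ-false y (suc i) y≢si = refl

swap-involutive : ∀ i y → swapVal i (swapVal i y) ≡ y
swap-involutive i y with y ≟ i | y ≟ suc i
... | yes refl | _ = trans (cong (swapVal i) (swap-i i)) (swap-suc-i i)
... | no _ | yes refl = trans (cong (swapVal i) (swap-suc-i i)) (swap-i i)
... | no y≢i | no y≢si = trans (cong (swapVal i) (swap-fix i y≢i y≢si)) (swap-fix i y≢i y≢si)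

swap-injective : ∀ i → Injective _≡_ _≡_ (swapVal i)
swap-injective i {x} {y} e = begin
  x                          ≡⟨ swap-involutive i x ⟨
  swapVal i (swapVal i x)    ≡⟨ cong (swapVal i) e ⟩
  swapVal i (swapVal i y)    ≡⟨ swap-involutive i y ⟩
  y                          ∎
  where open ≡-Reasoning

swap-monotone : ∀ i {x y} → x ≤ y → (x ≡ i → y ≡ suc i → ⊥) → swapVal i x ≤ swapVal i y
swap-monotone i {x} {y} x≤y not-pair with x ≟ i | x ≟ suc i | y ≟ i | y ≟ suc i
... | yes refl | _ | _ | yes refl = ⊥-elim (not-pair refl refl)
... | yes refl | _ | yes refl | no _ = ≤-refl
... | yes refl | _ | no y≢i | no y≢si rewrite swap-i i | swap-fix i y≢i y≢si = ≤∧≢⇒< x≤y (y≢i ∘′ sym)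
... | no _ | yes refl | yes refl | _ = ⊥-elim (1+n≰n x≤y)
... | no _ | yes refl | no _ | yes refl = ≤-refl
... | no _ | yes refl | no y≢i | no y≢si rewrite swap-suc-i i | swap-fix i y≢i y≢si = ≤-trans (n≤1+n i) x≤y
... | no x≢i | no x≢si | yes refl | _ rewrite swap-fix i x≢i x≢si | swap-i i = m≤n⇒m≤1+n x≤y
... | no x≢i | no x≢si | no _ | yes refl rewrite swap-fix i x≢i x≢si | swap-suc-i i = s≤s⁻¹ (≤∧≢⇒< x≤y x≢si)
... | no x≢i | no x≢si | no y≢i | no y≢si rewrite swap-fix i x≢i x≢si | swap-fix i y≢i y≢si = x≤y

swap-monotone-lacking : ∀ i xs → i ∉ xs ⊎ suc i ∉ xs → MonotoneOn (swapVal i) xs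
swap-monotone-lacking i xs (inj₁ i∉) x∈ _ x≤y = swap-monotone i x≤y (λ { refl _ → i∉ x∈ })
swap-monotone-lacking i xs (inj₂ si∉) _ y∈ x≤y = swap-monotone i x≤y (λ { _ refl → si∉ y∈ })

Precedes : ℕ → ℕ → List ℕ → Set
Precedes b a ys = occursLeftOf b a ys ≡ true

precedes-∈ : ∀ b a ys → Precedes b a ys → b ∈ ys
precedes-∈ b a (y ∷ ys) prec with y ≟ b
... | yes refl = here refl
... | no y≢b rewrite ≢⇒≡ᵇ-false y b y≢b with y ≡ᵇ a
...   | false = there (precedes-∈ b a ys prec)

precedes-skip : ∀ b a xs ys → a ∉ xs → b ∉ xs → occursLeftOf b a (xs ++ ys) ≡ occursLeftOf b a ys
precedes-skip b a [] ys _ _ = refl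
precedes-skip b a (x ∷ xs) ys a∉ b∉
  rewrite ≢⇒≡ᵇ-false x b (λ e → b∉ (here (sym e))) | ≢⇒≡ᵇ-false x a (λ e → a∉ (here (sym e))) =
  precedes-skip b a xs ys (a∉ ∘′ there) (b∉ ∘′ there)

precedes-++ˡ : ∀ b a xs ys → b ∉ ys → Precedes b a (xs ++ ys) → Precedes b a xs
precedes-++ˡ b a [] ys b∉ prec = ⊥-elim (b∉ (precedes-∈ b a ys prec))
precedes-++ˡ b a (x ∷ xs) ys b∉ prec with x ≡ᵇ b
... | true = refl
... | false with x ≡ᵇ a
...   | true = prec
...   | false = precedes-++ˡ b a xs ys b∉ prec

not-precedes : ∀ b a xs ys → a ∈ xs → b ∉ xs → ¬ Precedes b a (xs ++ ys)
not-precedes b a (x ∷ xs) ys a∈ b∉ prec rewrite ≢⇒≡ᵇ-false x b (λ e → b∉ (here (sym e))) with a∈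
... | here refl rewrite ≡ᵇ-refl x with () ← prec
... | there a∈xs with x ≡ᵇ a
...   | true with () ← prec
...   | false = not-precedes b a xs ys a∈xs (b∉ ∘′ there) prec

Unique-++⁻ : ∀ (xs ys : List ℕ) → Unique (xs ++ ys) → Unique xs × Unique ys × (∀ {z} → z ∈ xs → z ∉ ys)
Unique-++⁻ [] ys u = [] , u , λ ()
Unique-++⁻ (x ∷ xs) ys (x∉ ∷ u) with uxs , uys , disjoint ← Unique-++⁻ xs ys u =
  (All.++⁻ˡ xs x∉ ∷ uxs) , uys , λ { (here refl) z∈ys → All.lookup (All.++⁻ʳ xs x∉) z∈ys refl
                                   ; (there z∈xs) → disjoint z∈xs }

record DistinctSplit (x : ℕ) (xs : List ℕ) : Set where
  field
    unique-left : Unique (left x xs)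
    unique-right : Unique (right x xs)
    top∉left : top x xs ∉ left x xs
    top∉right : top x xs ∉ right x xs
    disjoint : ∀ {z} → z ∈ left x xs → z ∉ right x xs

distinct-split : ∀ x xs → Unique (x ∷ xs) → DistinctSplit x xs
distinct-split x xs u
  with uL , m∷uR , disj ← Unique-++⁻ (left x xs) (top x xs ∷ right x xs) (subst Unique (cons-split x xs) u) = record
  { unique-left = uL
  ; unique-right = unique-tail m∷uR
  ; top∉left = λ m∈L → disj m∈L (here refl)
  ; top∉right = Unique.Unique[x∷xs]⇒x∉xs m∷uR
  ; disjoint = λ z∈L z∈R → disj z∈L (there z∈R)
  }
  where
  unique-tail : ∀ {m R} → Unique (m ∷ R) → Unique R
  unique-tail (_ ∷ uR) = uR

-- In s(x ∷ xs) the maximum comes last and, the entries being distinct, nowhere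
-- else; hence it precedes no other entry.
top-precedes-nothing : ∀ k x xs {a} → Unique (x ∷ xs) → length (x ∷ xs) ≤ suc k →
  a ∈ x ∷ xs → a ≢ top x xs → ¬ Precedes (top x xs) a (sFuel (suc k) (x ∷ xs))
top-precedes-nothing k x xs {a} u len a∈ a≢m prec =
  not-precedes m a (sL ++ sR) [ m ] a∈sLsR m∉sLsR
    (subst (Precedes m a) (trans (sFuel-cons k x xs) (sym (++-assoc sL sR [ m ]))) prec)
  where
  open DistinctSplit (distinct-split x xs u)
  m = top x xs
  L = left x xs
  R = right x xs
  sL = sFuel k L
  sR = sFuel k R
  lens = split-length k x xs len
  m∉sLsR : m ∉ sL ++ sR
  m∉sLsR m∈ with ∈-++⁻ sL m∈
  ... | inj₁ m∈sL = top∉left (sFuel-⊆ k L m∈sL)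
  ... | inj₂ m∈sR = top∉right (sFuel-⊆ k R m∈sR)
  a∈sLsR : a ∈ sL ++ sR
  a∈sLsR with ∈-left-or-right x xs a∈ a≢m
  ... | inj₁ a∈L = ∈-++⁺ˡ (sFuel-⊇ k L (proj₁ lens) a∈L)
  ... | inj₂ a∈R = ∈-++⁺ʳ sL (sFuel-⊇ k R (proj₂ lens) a∈R)

sFuel-swap : ∀ i k xs → Unique xs → length xs ≤ k →
  (i ∈ xs → suc i ∈ xs → Precedes (suc i) i (sFuel k xs)) →
  sFuel k (map (swapVal i) xs) ≡ map (swapVal i) (sFuel k xs)
sFuel-swap i zero xs _ _ _ = refl
sFuel-swap i (suc k) [] _ _ _ = refl
-- If i or i+1 is missing, σ_i is a monotone relabelling; otherwise recurse into L and R.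
sFuel-swap i (suc k) (x ∷ xs) u len prec with i ∈? x ∷ xs | suc i ∈? x ∷ xs
... | no i∉ | _ =
  sFuel-map-monotone (swapVal i) (swap-injective i) (suc k) (x ∷ xs) (swap-monotone-lacking i (x ∷ xs) (inj₁ i∉))
... | yes _ | no si∉ =
  sFuel-map-monotone (swapVal i) (swap-injective i) (suc k) (x ∷ xs) (swap-monotone-lacking i (x ∷ xs) (inj₂ si∉))
... | yes i∈ | yes si∈ = sFuel-map-step σ k x xs (swap-injective i) below-top
        (sFuel-swap i k L unique-left (proj₁ lens) precL) (sFuel-swap i k R unique-right (proj₂ lens) precR)
  where
  open DistinctSplit (distinct-split x xs u)
  σ = swapVal i
  m = top x xs
  L = left x xs
  R = right x xs
  sL = sFuel k L
  sR = sFuel k R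
  lens = split-length k x xs len
  -- i+1 precedes i, so i+1 is not the maximum …
  si≢m : suc i ≢ m
  si≢m si≡m = top-precedes-nothing k x xs u len i∈ (λ i≡m → 1+n≢n (trans si≡m (sym i≡m)))
                (subst (λ b → Precedes b i (sFuel (suc k) (x ∷ xs))) si≡m (prec i∈ si∈))
  -- … hence σ keeps the maximum on top.
  below-top : ∀ {y} → y ∈ x ∷ xs → σ y ≤ σ m
  below-top y∈ = swap-monotone i (maxOf-≥ x xs y∈) (λ _ m≡si → si≢m (sym m≡si))
  prec-sLsRm : Precedes (suc i) i (sL ++ sR ++ [ m ])
  prec-sLsRm = subst (Precedes (suc i) i) (sFuel-cons k x xs) (prec i∈ si∈)
  si∉[m] : suc i ∉ [ m ]
  si∉[m] (here si≡m) = si≢m si≡m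
  -- The hypothesis passes to L and to R, since i+1 lies in only one of them and is not m.
  precL : i ∈ L → suc i ∈ L → Precedes (suc i) i sL
  precL _ si∈L = precedes-++ˡ (suc i) i sL (sR ++ [ m ]) si∉sRm prec-sLsRm
    where
    si∉sRm : suc i ∉ sR ++ [ m ]
    si∉sRm si∈sRm with ∈-++⁻ sR si∈sRm
    ... | inj₁ si∈sR = disjoint si∈L (sFuel-⊆ k R si∈sR)
    ... | inj₂ si∈m = si∉[m] si∈m
  precR : i ∈ R → suc i ∈ R → Precedes (suc i) i sR
  precR i∈R si∈R = precedes-++ˡ (suc i) i sR [ m ] si∉[m]
    (trans (sym (precedes-skip (suc i) i sL (sR ++ [ m ]) (∉L i∈R) (∉L si∈R))) prec-sLsRm)
    where
    ∉L : ∀ {z} → z ∈ R → z ∉ sL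
    ∉L z∈R z∈sL = disjoint (sFuel-⊆ k L z∈sL) z∈R

Unique-resp-↭ : ∀ {xs ys : List ℕ} → xs ↭ ys → Unique xs → Unique ys
Unique-resp-↭ p = PermSetoid.Unique-resp-↭ (setoid ℕ) (↭⇒↭ₛ p)

∈⇒↭-front : ∀ {z} {xs : List ℕ} → z ∈ xs → ∃ λ rest → xs ↭ z ∷ rest
∈⇒↭-front {z} z∈ with ys , zs , refl ← ∈-∃++ z∈ = ys ++ zs , Perm.shift z ys zs

∈-tail : ∀ {z y} {ys : List ℕ} → z ≢ y → z ∈ y ∷ ys → z ∈ ys
∈-tail z≢y (here z≡y) = ⊥-elim (z≢y z≡y)
∈-tail z≢y (there z∈) = z∈

swap-↭ : ∀ i xs → Unique xs → i ∈ xs → suc i ∈ xs → map (swapVal i) xs ↭ xs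
swap-↭ i xs u i∈ si∈
  with rest₁ , xs↭ ← ∈⇒↭-front i∈
  with rest , rest₁↭ ← ∈⇒↭-front (∈-tail 1+n≢n (Perm.∈-resp-↭ xs↭ si∈)) = begin
  map σ xs                  ↭⟨ Perm.map⁺ σ xs↭′ ⟩
  σ i ∷ σ (suc i) ∷ map σ rest ≡⟨ cong₂ (λ a b → a ∷ b ∷ map σ rest) (swap-i i) (swap-suc-i i) ⟩
  suc i ∷ i ∷ map σ rest    ≡⟨ cong (λ r → suc i ∷ i ∷ r) (map-id-local (All.tabulate fixed)) ⟩
  suc i ∷ i ∷ rest          ↭⟨ swap (suc i) i ↭-refl ⟩
  i ∷ suc i ∷ rest          ↭⟨ xs↭′ ⟨
  xs                        ∎
  where
  open PermutationReasoning
  σ = swapVal i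
  xs↭′ : xs ↭ i ∷ suc i ∷ rest
  xs↭′ = ↭-trans xs↭ (prep i rest₁↭)
  u′ : Unique (i ∷ suc i ∷ rest)
  u′ = Unique-resp-↭ xs↭′ u
  fixed : ∀ {y} → y ∈ rest → σ y ≡ y
  fixed {y} y∈ with i∉ ∷ si∉ ∷ _ ← u′ =
    swap-fix i (λ { refl → All.lookup i∉ (there y∈) refl }) (λ { refl → All.lookup si∉ y∈ refl })

range-unique : ∀ n → Unique (range n)
range-unique n = Unique.map⁺ suc-injective (Unique.upTo⁺ n)

∈-range : ∀ n {j} → 1 ≤ j → j ≤ n → j ∈ range n
∈-range n {suc j} _ j<n = ∈-map⁺ suc (∈-upTo⁺ j<n)

preimage-swap : ∀ n i π τ → 1 ≤ i → suc i ≤ n → Precedes (suc i) i π →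
  Preimage n π τ → Preimage n (map (swapVal i) π) (map (swapVal i) τ)
preimage-swap n i π τ 1≤i si≤n prec (τ↭ , refl) = ↭-trans (swap-↭ i τ uτ i∈ si∈) τ↭ , sorts
  where
  σ = swapVal i
  uτ : Unique τ
  uτ = Unique-resp-↭ (↭-sym τ↭) (range-unique n)
  i∈ : i ∈ τ
  i∈ = Perm.∈-resp-↭ (↭-sym τ↭) (∈-range n 1≤i (≤-trans (n≤1+n i) si≤n))
  si∈ : suc i ∈ τ
  si∈ = Perm.∈-resp-↭ (↭-sym τ↭) (∈-range n (s≤s z≤n) si≤n)
  sorts : s (map σ τ) ≡ map σ (s τ)
  sorts = begin
    sFuel (length (map σ τ)) (map σ τ) ≡⟨ cong (λ k → sFuel k (map σ τ)) (length-map σ τ) ⟩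
    sFuel (length τ) (map σ τ)         ≡⟨ sFuel-swap i (length τ) τ uτ ≤-refl (λ _ _ → prec) ⟩
    map σ (s τ)                        ∎
    where open ≡-Reasoning

PreimageFamily : ℕ → List ℕ → ℕ → Set
PreimageFamily n π ℓ = ∃ λ (T : List (List ℕ)) → Unique T × All (Preimage n π) T × ℓ ≤ length T

-- One step t̃_i keeps a family of ℓ preimages: if t̃_i acts, apply σ_i to every member
-- (an injection by `preimage-swap`); otherwise t̃_i π = π.
family-ttilde : ∀ {n π ℓ} i → 1 ≤ i → suc i ≤ n → PreimageFamily n π ℓ → PreimageFamily n (ttilde i π) ℓ
family-ttilde {n} {π} {ℓ} i 1≤i si≤n (T , u , pre , ℓ≤) with occursLeftOf (suc i) i π in prec
... | false = T , u , pre , ℓ≤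
... | true =
  map (map σ) T ,
  Unique.map⁺ (map-injective (swap-injective i)) u ,
  All.map⁺ (All.map (preimage-swap n i π _ 1≤i si≤n prec) pre) ,
  subst (ℓ ≤_) (sym (length-map (map σ) T)) ℓ≤
  where σ = swapVal i

family-along : ∀ {n π ℓ} is → All (λ i → 1 ≤ i × suc i ≤ n) is →
  PreimageFamily n π ℓ → PreimageFamily n (applySeq is π) ℓ
family-along [] [] F = F
family-along (i ∷ is) ((1≤i , si≤n) ∷ valid) F = family-along is valid (family-ttilde i 1≤i si≤n F)

theorem3p3 : (n : ℕ) (π π' : List ℕ) → InS n π → InS n π' → LeftLe n π' π →
    (T : List (List ℕ)) → Unique T → All (Preimage n π) T →
    ∃ λ (T' : List (List ℕ)) → Unique T' × All (Preimage n π') T' × length T ≤ length T'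
theorem3p3 n π π' _ _ (is , valid , applySeq≡π') T u pre =
  subst (λ ρ → PreimageFamily n ρ (length T)) applySeq≡π' (family-along is valid (T , u , pre , ≤-refl))
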